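{- Let $\mathcal R$ be a finite set of located rewrite rules. Every strategic graph program $[S, G_P^Q]$ whose strategy $S$ is a core strategy over $\mathcal R$ (i.e. one not using the constructs $\mathsf{OneNgb}$, $\mathsf{one}$, $\mathsf{ppick}$, $\mathsf{orelse}$, $\mathsf{repeat}$) has at most one complete result set.
   Context: Port graphs. A port graph consists of a finite set of nodes, each carrying a name (label), a finite set of ports (each with a label and attributes) determined by the node name, and node attributes; and a finite set of undirected edges, each attached to two (node, port) pairs and carrying a label and attributes (several edges between the same ports are allowed). Union $\cup$, intersection $\cap$ and difference $\setminus$ of subgraphs of a port graph are taken on the sets of nodes, ports and edges. A port graph rewrite rule $L \Rightarrow R$ consists of port graphs $L, R$ (which may contain variables) and an arrow node describing how $R$ is reconnected to the context. A morphism $g: L \to G$ maps nodes, ports and edges of $L$ to those of $G$, preserving non-variable labels, edge attachments and attribute/value pairs, and instantiating variables. $G \to^{g}_{L\Rightarrow R} G'$ means $G'$ is obtained from $G$ by replacing $g(L)$ by $g(R)$ and reconnecting as prescribed by the arrow node. Located graphs and rules. A located graph $G_P^Q$ is a port graph $G$ with two subgraphs $P$ (position) and $Q$ (banned subgraph). A located rewrite rule $L_W \Rightarrow R_M^N$ is a rule $L\Rightarrow R$ with an optional subgraph $W$ of $L$ and optional disjoint subgraphs $M,N$ of $R$ (defaults $M = R$, $N = \emptyset$). We write $G_P^Q \to^{g}_{L_W\Rightarrow R_M^N} {G'}_{P'}^{Q'}$ if $G \to^{g}_{L\Rightarrow R} G'$ with $g(L)\cap P = g(W)$ (or $g(L)\cap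 P \neq \emptyset$ if $W$ is not given), $g(L)\cap Q = \emptyset$, $P' = (P\setminus g(L))\cup g(M)$ and $Q' = Q \cup g(N)$. The legal set $LS_{L_W\Rightarrow R_M^N}(G_P^Q)$ is the set of located graphs ${G_i}_{P_i}^{Q_i}$ ($1\le i\le k$) with $G_P^Q \to^{g_i}_{L_W\Rightarrow R_M^N} {G_i}_{P_i}^{Q_i}$ for pairwise different morphisms $g_1,\dots,g_k$ (all such morphisms). Core strategies. Focusing expressions: $F ::= \mathtt{CrtGraph} \mid \mathtt{CrtPos} \mid \mathtt{CrtBan} \mid \mathtt{AllNgb}(F) \mid \mathtt{NextNgb}(F) \mid \mathtt{Property}(\rho,F) \mid F\cup F \mid F\cap F \mid F\setminus F \mid \emptyset$, where $\rho$ is a decidable property of nodes/ports/edges. Each $F$ denotes a function from located graphs $G_P^Q$ to subgraphs of $G$: $\mathtt{CrtGraph}, \mathtt{CrtPos}, \mathtt{CrtBan}$ return $G, P, Q$; $\mathtt{AllNgb}(F)$ returns all immediate successors (nodes having a port connected to a port) of nodes of $F(G_P^Q)$; $\mathtt{NextNgb}(F)$ the immediate successors via ports labelled "next"; $\mathtt{Property}(\rho,F)$ the elements of $F(G_P^Q)$ satisfying $\rho$; $\cup,\cap,\setminus$ act pointwise; $\emptyset$ is the empty graph. Core strategies: $S ::= \mathsf{Id} \mid \mathsf{Fail} \mid \mathsf{all}(T) \mid \mathsf{setPos}(F) \mid \mathsf{setBan}(F) \mid \mathsf{isEmpty}(F) \mid S;S \mid \mathsf{while}(S)\,\mathsf{do}(S)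 \mid \mathsf{if}(S)\,\mathsf{then}(S)\,\mathsf{else}(S)$, where $T$ ranges over the located rules in $\mathcal R$. Semantics. A strategic graph program is a pair $[S, G_P^Q]$; it is a result if $S$ is $\mathsf{Id}$ or $\mathsf{Fail}$. A configuration is a finite multiset of strategic graph programs. The relation $\to$ from a program to a configuration is the least relation satisfying (there are no transitions from results): - $[\mathsf{all}(L_W\Rightarrow R_M^N), G_P^Q] \to \{[\mathsf{Id}, {G_1}_{P_1}^{Q_1}],\dots,[\mathsf{Id}, {G_k}_{P_k}^{Q_k}]\}$ if $LS_{L_W\Rightarrow R_M^N}(G_P^Q) = \{{G_1}_{P_1}^{Q_1},\dots,{G_k}_{P_k}^{Q_k}\}\neq\emptyset$, and $\to \{[\mathsf{Fail}, G_P^Q]\}$ if the legal set is empty; - $[\mathsf{setPos}(F), G_P^Q] \to \{[\mathsf{Id}, G_{F(G_P^Q)}^Q]\}$; $[\mathsf{setBan}(F), G_P^Q] \to \{[\mathsf{Id}, G_P^{F(G_P^Q)}]\}$; $[\mathsf{isEmpty}(F), G_P^Q] \to \{[\mathsf{Id}, G_P^Q]\}$ if $F(G_P^Q) = \emptyset$ and $\to\{[\mathsf{Fail}, G_P^Q]\}$ otherwise; - $[\mathsf{Id};S, G_P^Q] \to \{[S, G_P^Q]\}$; $[\mathsf{Fail};S, G_P^Q] \to \{[\mathsf{Fail}, G_P^Q]\}$; if $[S_1, G_P^Q] \to \{[S_1^1, {G_1}_{P_1}^{Q_1}],\dots,[S_1^k, {G_k}_{P_k}^{Q_k}]\}$ then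 $[S_1;S_2, G_P^Q] \to \{[S_1^1;S_2, {G_1}_{P_1}^{Q_1}],\dots,[S_1^k;S_2, {G_k}_{P_k}^{Q_k}]\}$; - $[\mathsf{if}(S_1)\mathsf{then}(S_2)\mathsf{else}(S_3), G_P^Q] \to \{[S_2, G_P^Q]\}$ if $\{[S_1, G_P^Q]\} \longrightarrow^* M$ for some configuration $M$ containing some $[\mathsf{Id}, G']$; and $\to \{[S_3, G_P^Q]\}$ if $\{[S_1, G_P^Q]\}\longrightarrow^* \{[\mathsf{Fail}, G_1],\dots,[\mathsf{Fail}, G_n]\}$; - $[\mathsf{while}(S_1)\mathsf{do}(S_2), G_P^Q] \to \{[\mathsf{if}(S_1)\mathsf{then}(S_2;\mathsf{while}(S_1)\mathsf{do}(S_2))\mathsf{else}(\mathsf{Id}), G_P^Q]\}$. The transition relation $\longrightarrow$ on configurations: $\{O_1,\dots,O_k,V_1,\dots,V_j\} \longrightarrow \{O'_{11},\dots,O'_{1m_1},\dots,O'_{k1},\dots,O'_{km_k},V_1,\dots,V_j\}$ whenever $k\ge 1$, $V_1,\dots,V_j$ are results, and $O_i \to \{O'_{i1},\dots,O'_{im_i}\}$ for each $1\le i\le k$; $\longrightarrow^*$ is its reflexive transitive closure. A configuration is terminal if no $\longrightarrow$-transition applies to it. Result sets. The result set of a sequence of $\longrightarrow$-transitions out of $\{[S, G_P^Q]\}$ is the set of all results occurring in the configurations of the sequence. If such a sequence ends in a terminal configuration, its result set is a complete result set of the program $[S, G_P^Q]$; if the program reaches no terminal configuration, its complete result set is undefined.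 -}

module Defs where

open import Data.Bool using (Bool)
open import Data.Maybe using (Maybe; just; nothing)
open import Data.List using (List; []; _∷_; _++_; map; [_])
open import Data.List.Membership.Propositional using (_∈_)
open import Data.List.Relation.Unary.All using (All)
open import Data.List.Relation.Unary.Any using (Any)
open import Data.List.Relation.Unary.Unique.Propositional using (Unique)
open import Data.Product using (Σ; _×_; ∃)
open import Data.Sum using (_⊎_)
open import Relation.Nullary using (¬_)
open import Relation.Binary.PropositionalEquality using (_≡_; _≢_)

record PortGraphFramework : Set₁ where
  field
    Graph     : Set
    Sub       : Set
    ∅ₛ        : Sub
    whole     : Graph → Sub
    _∪ₛ_      : Sub → Sub → Sub
    _∩ₛ_      : Sub → Sub → Sub
    _∖ₛ_      : Sub → Sub → Sub
    Elem      : Set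
    -- AllNgb / NextNgb: immediate successors (resp. via "next" ports)
    allNgb    : Graph → Sub → Sub
    nextNgb   : Graph → Sub → Sub
    property  : (Graph → Elem → Bool) → Graph → Sub → Sub
    -- located rewrite rules  L_W ⇒ R_M^N
    LocRule   : Set
    Mor       : LocRule → Graph → Set
    applyRule : (T : LocRule) (G : Graph) → Mor T G → Graph
    -- g(L) ⊆ G, g(W) (nothing if W is not given), g(M), g(N) ⊆ G'
    -- (M defaults to R and N to ∅ when not given)
    imgL      : (T : LocRule) (G : Graph) → Mor T G → Sub
    imgW      : (T : LocRule) (G : Graph) → Mor T G → Maybe Sub
    imgM      : (T : LocRule) (G : Graph) → Mor T G → Sub
    imgN      : (T : LocRule) (G : Graph) → Mor T G → Sub

module Sem (𝔉 : PortGraphFramework)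
           (ℛ : List (PortGraphFramework.LocRule 𝔉)) where
  open PortGraphFramework 𝔉

  record LocGraph : Set where
    constructor _⟨_,_⟩
    field
      graph : Graph
      pos   : Sub
      ban   : Sub
  open LocGraph public

  data Focus : Set where
    CrtGraph CrtPos CrtBan : Focus
    AllNgb NextNgb : Focus → Focus
    Property : (Graph → Elem → Bool) → Focus → Focus
    _∪F_ _∩F_ _∖F_ : Focus → Focus → Focus
    ∅F : Focus

  ⟦_⟧F : Focus → LocGraph → Sub
  ⟦ CrtGraph ⟧F A = whole (graph A)
  ⟦ CrtPos ⟧F A = pos A
  ⟦ CrtBan ⟧F A = ban A
  ⟦ AllNgb F ⟧F A = allNgb (graph A) (⟦ F ⟧F A)
  ⟦ NextNgb F ⟧F A = nextNgb (graph A) (⟦ F ⟧F A)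
  ⟦ Property ρ F ⟧F A = property ρ (graph A) (⟦ F ⟧F A)
  ⟦ F ∪F F′ ⟧F A = ⟦ F ⟧F A ∪ₛ ⟦ F′ ⟧F A
  ⟦ F ∩F F′ ⟧F A = ⟦ F ⟧F A ∩ₛ ⟦ F′ ⟧F A
  ⟦ F ∖F F′ ⟧F A = ⟦ F ⟧F A ∖ₛ ⟦ F′ ⟧F A
  ⟦ ∅F ⟧F A = ∅ₛ

  data Strat : Set where
    Id Fail : Strat
    all : (T : LocRule) → T ∈ ℛ → Strat
    setPos setBan isEmpty : Focus → Strat
    _⨾_ : Strat → Strat → Strat
    while_do′_ : Strat → Strat → Strat
    if_then_else_ : Strat → Strat → Strat → Strat

  record Program : Set where
    constructor [_,_]
    field
      strat : Strat
      lgraph : LocGraph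
  open Program public

  data IsResult : Program → Set where
    id-res   : ∀ {A} → IsResult [ Id , A ]
    fail-res : ∀ {A} → IsResult [ Fail , A ]

  Config : Set
  Config = List Program

  PosCond : Maybe Sub → Sub → Sub → Set
  PosCond (just W) gL P = (gL ∩ₛ P) ≡ W
  PosCond nothing  gL P = ¬ ((gL ∩ₛ P) ≡ ∅ₛ)

  Legal : (T : LocRule) (A : LocGraph) → Mor T (graph A) → Set
  Legal T A g = PosCond (imgW T (graph A) g) (imgL T (graph A) g) (pos A)
              × ((imgL T (graph A) g ∩ₛ ban A) ≡ ∅ₛ)

  located : (T : LocRule) (A : LocGraph) → Mor T (graph A) → LocGraph
  located T A g =
    applyRule T (graph A) g
      ⟨ (pos A ∖ₛ imgL T (graph A) g) ∪ₛ imgM T (graph A) g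
      , ban A ∪ₛ imgN T (graph A) g ⟩

  IsLegalSet : (T : LocRule) (A : LocGraph) → List LocGraph → Set
  IsLegalSet T A xs =
    Σ (List (Mor T (graph A))) λ gs →
        Unique gs
      × All (Legal T A) gs
      × (∀ g → Legal T A g → g ∈ gs)
      × (xs ≡ map (located T A) gs)

  mutual
    data _↦_ : Program → Config → Set where
      all-ok   : ∀ {T m A xs} → IsLegalSet T A xs → xs ≢ [] →
                 [ all T m , A ] ↦ map (λ B → [ Id , B ]) xs
      all-fail : ∀ {T m A} → IsLegalSet T A [] →
                 [ all T m , A ] ↦ [ [ Fail , A ] ]
      setPos-↦ : ∀ {F A} →
                 [ setPos F , A ] ↦ [ [ Id , graph A ⟨ ⟦ F ⟧F A , ban A ⟩ ] ]
      setBan-↦ : ∀ {F A} →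
                 [ setBan F , A ] ↦ [ [ Id , graph A ⟨ pos A , ⟦ F ⟧F A ⟩ ] ]
      isEmpty-id   : ∀ {F A} → ⟦ F ⟧F A ≡ ∅ₛ →
                     [ isEmpty F , A ] ↦ [ [ Id , A ] ]
      isEmpty-fail : ∀ {F A} → ¬ (⟦ F ⟧F A ≡ ∅ₛ) →
                     [ isEmpty F , A ] ↦ [ [ Fail , A ] ]
      seq-id   : ∀ {S A} → [ Id ⨾ S , A ] ↦ [ [ S , A ] ]
      seq-fail : ∀ {S A} → [ Fail ⨾ S , A ] ↦ [ [ Fail , A ] ]
      seq-step : ∀ {S₁ S₂ A cs} → [ S₁ , A ] ↦ cs →
                 [ S₁ ⨾ S₂ , A ] ↦ map (λ p → [ strat p ⨾ S₂ , lgraph p ]) cs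
      if-then  : ∀ {S₁ S₂ S₃ A M} → [ [ S₁ , A ] ] ⟶* M →
                 Any (λ p → strat p ≡ Id) M →
                 [ if S₁ then S₂ else S₃ , A ] ↦ [ [ S₂ , A ] ]
      if-else  : ∀ {S₁ S₂ S₃ A M} → [ [ S₁ , A ] ] ⟶* M →
                 All (λ p → strat p ≡ Fail) M →
                 [ if S₁ then S₂ else S₃ , A ] ↦ [ [ S₃ , A ] ]
      while-↦  : ∀ {S₁ S₂ A} →
                 [ while S₁ do′ S₂ , A ] ↦
                   [ [ if S₁ then (S₂ ⨾ (while S₁ do′ S₂)) else Id , A ] ]

    data StepAll : Config → Config → Set where
      []ₛ    : StepAll [] []
      keep   : ∀ {p cs cs′} → IsResult p → StepAll cs cs′ →
               StepAll (p ∷ cs) (p ∷ cs′)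
      change : ∀ {p ps cs cs′} → p ↦ ps → StepAll cs cs′ →
               StepAll (p ∷ cs) (ps ++ cs′)

    data _⟶_ : Config → Config → Set where
      step : ∀ {C C′} → Any (λ p → ¬ IsResult p) C → StepAll C C′ → C ⟶ C′

    data _⟶*_ : Config → Config → Set where
      ε   : ∀ {C} → C ⟶* C
      _◅_ : ∀ {C C′ C″} → C ⟶ C′ → C′ ⟶* C″ → C ⟶* C″

  Terminal : Config → Set
  Terminal C = ∀ C′ → ¬ (C ⟶ C′)

  data Run : Config → Config → Set where
    done : ∀ {C} → Run C C
    next : ∀ {C C′ D} → C ⟶ C′ → Run C′ D → Run C D

  _∈Run_ : ∀ {C D} → Program → Run C D → Set
  _∈Run_ {C} x done = x ∈ C
  _∈Run_ {C} x (next _ r) = x ∈ C ⊎ x ∈Run r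

  InResultSet : ∀ {C D} → Program → Run C D → Set
  InResultSet x r = IsResult x × x ∈Run r

  record CompleteRun (p : Program) : Set where
    field
      final    : Config
      run      : Run [ p ] final
      terminal : Terminal final

module Submission where

-- The one-step relation ↦ is deterministic up to the order and multiplicity
-- of the configuration it produces. For all(T) this holds because any two
-- enumerations of the legal set list the images of the same legal morphisms;
-- for if-then-else it holds because a condition whose evaluation reaches a
-- configuration containing Id cannot also reach one consisting of Fail only:
-- runs from configurations with the same members keep the same members, and
-- results, once produced, are never removed. This determinism is lifted to the
-- parallel steps ⟶, so two runs out of the same program proceed in lockstep,
-- become terminal at the same step and pass through the same programs.

open import Defs
open import Data.List using (List; []; _∷_; _++_)
open import Data.List.Membership.Propositional using (_∈_; find)
open import Data.List.Membership.Propositional.Properties using (∈-++⁻)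
open import Data.List.Relation.Binary.Subset.Propositional using (_⊆_)
open import Data.List.Relation.Binary.Subset.Propositional.Properties
  using (⊆-refl; ⊆[]⇒≡[]; map⁺; xs⊆xs++ys; xs⊆ys++xs; Any-resp-⊆)
open import Data.List.Relation.Unary.All using (All; lookup)
open import Data.List.Relation.Unary.Any using (Any; here; there)
open import Data.Product using (_×_; _,_; proj₁; proj₂; ∃)
open import Data.Sum using (_⊎_; inj₁; inj₂)
open import Data.Empty using (⊥; ⊥-elim)
open import Function using (_∘_)
open import Relation.Nullary using (¬_)
open import Relation.Binary.PropositionalEquality using (_≡_; _≢_; refl; sym; trans)

module CoreStrategies (𝔉 : PortGraphFramework)
                      (ℛ : List (PortGraphFramework.LocRule 𝔉)) where
  open PortGraphFramework 𝔉 using (LocRule)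
  open Sem 𝔉 ℛ

  private variable
    T : LocRule
    A : LocGraph
    xs ys : List LocGraph
    p q : Program
    ps qs : Config
    C C′ D D′ M N : Config

  Succeeded Failed : Config → Set
  Succeeded M = Any (λ p → strat p ≡ Id) M
  Failed M = All (λ p → strat p ≡ Fail) M

  Id≢Fail : Id ≢ Fail
  Id≢Fail ()

  succeeded-result : strat p ≡ Id → IsResult p
  succeeded-result {[ Id , _ ]} refl = id-res

  failed-result : strat p ≡ Fail → IsResult p
  failed-result {[ Fail , _ ]} refl = fail-res

  result-stuck : IsResult p → ¬ (p ↦ ps)
  result-stuck id-res ()
  result-stuck fail-res ()

  legalSet-⊆ : IsLegalSet T A xs → IsLegalSet T A ys → xs ⊆ ys
  legalSet-⊆ {T} {A} (_ , _ , gs-legal , _ , refl) (_ , _ , _ , hs-complete , refl) =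
    map⁺ (located T A) (λ g∈gs → hs-complete _ (lookup gs-legal g∈gs))

  legalSet-empty : IsLegalSet T A xs → IsLegalSet T A [] → xs ≡ []
  legalSet-empty L L∅ = ⊆[]⇒≡[] (legalSet-⊆ L L∅)

  stepAll-lookup : StepAll C C′ → p ∈ C →
                   (IsResult p × p ∈ C′) ⊎ ∃ λ ps → p ↦ ps × ps ⊆ C′
  stepAll-lookup (keep r _) (here refl) = inj₁ (r , here refl)
  stepAll-lookup (change {ps = ps} d _) (here refl) = inj₂ (ps , d , xs⊆xs++ys ps _)
  stepAll-lookup (keep _ s) (there p∈C) with stepAll-lookup s p∈C
  ... | inj₁ (r , p∈C′) = inj₁ (r , there p∈C′)
  ... | inj₂ (ps , d , ps⊆C′) = inj₂ (ps , d , there ∘ ps⊆C′)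
  stepAll-lookup (change {ps = ps} _ s) (there p∈C) with stepAll-lookup s p∈C
  ... | inj₁ (r , p∈C′) = inj₁ (r , xs⊆ys++xs _ ps p∈C′)
  ... | inj₂ (qs , d , qs⊆C′) = inj₂ (qs , d , xs⊆ys++xs _ ps ∘ qs⊆C′)

  stepAll-origin : StepAll C C′ → q ∈ C′ →
                   (IsResult q × q ∈ C) ⊎ ∃ λ p → ∃ λ ps → p ∈ C × p ↦ ps × q ∈ ps
  stepAll-origin (keep r _) (here refl) = inj₁ (r , here refl)
  stepAll-origin (keep _ s) (there q∈C′) with stepAll-origin s q∈C′
  ... | inj₁ (r , q∈C) = inj₁ (r , there q∈C)
  ... | inj₂ (p , ps , p∈C , d , q∈ps) = inj₂ (p , ps , there p∈C , d , q∈ps)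
  stepAll-origin (change {ps = ps} d s) q∈ps++C′ with ∈-++⁻ ps q∈ps++C′
  ... | inj₁ q∈ps = inj₂ (_ , ps , here refl , d , q∈ps)
  ... | inj₂ q∈C′ with stepAll-origin s q∈C′
  ...   | inj₁ (r , q∈C) = inj₁ (r , there q∈C)
  ...   | inj₂ (p′ , ps′ , p′∈C , d′ , q∈ps′) = inj₂ (p′ , ps′ , there p′∈C , d′ , q∈ps′)

  stepAll-keeps-result : StepAll C C′ → IsResult p → p ∈ C → p ∈ C′
  stepAll-keeps-result s r p∈C with stepAll-lookup s p∈C
  ... | inj₁ (_ , p∈C′) = p∈C′
  ... | inj₂ (_ , d , _) = ⊥-elim (result-stuck r d)

  ⟶*-keeps-result : C ⟶* M → IsResult p → p ∈ C → p ∈ M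
  ⟶*-keeps-result ε _ p∈C = p∈C
  ⟶*-keeps-result (step _ s ◅ steps) r p∈C =
    ⟶*-keeps-result steps r (stepAll-keeps-result s r p∈C)

  success-survives : C ⊆ D → D ⟶* N → Succeeded C → Failed N → ⊥
  success-survives C⊆D D⟶*N succeeded failed =
    let _ , p∈C , p-id = find succeeded
        p∈N = ⟶*-keeps-result D⟶*N (succeeded-result p-id) (C⊆D p∈C)
    in Id≢Fail (trans (sym p-id) (lookup failed p∈N))

  active-not-failed : C ⊆ M → Failed M → ¬ Any (¬_ ∘ IsResult) C
  active-not-failed C⊆M failed active =
    let _ , p∈C , p-active = find active
    in p-active (failed-result (lookup failed (C⊆M p∈C)))

  -- Each lemma of this block terminates by recursion on its first
  -- derivation, which is why the mirror images stepAll-⊇ and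
  -- failure-excludes-success cannot be obtained by swapping arguments.
  mutual
    ↦-deterministic : p ↦ ps → p ↦ qs → ps ⊆ qs × qs ⊆ ps
    ↦-deterministic (all-ok L _) (all-ok L′ _) =
      map⁺ (λ B → [ Id , B ]) (legalSet-⊆ L L′) , map⁺ (λ B → [ Id , B ]) (legalSet-⊆ L′ L)
    ↦-deterministic (all-ok L ne) (all-fail L∅) = ⊥-elim (ne (legalSet-empty L L∅))
    ↦-deterministic (all-fail L∅) (all-ok L ne) = ⊥-elim (ne (legalSet-empty L L∅))
    ↦-deterministic (all-fail _) (all-fail _) = ⊆-refl , ⊆-refl
    ↦-deterministic setPos-↦ setPos-↦ = ⊆-refl , ⊆-refl
    ↦-deterministic setBan-↦ setBan-↦ = ⊆-refl , ⊆-refl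
    ↦-deterministic (isEmpty-id _) (isEmpty-id _) = ⊆-refl , ⊆-refl
    ↦-deterministic (isEmpty-id e) (isEmpty-fail ne) = ⊥-elim (ne e)
    ↦-deterministic (isEmpty-fail ne) (isEmpty-id e) = ⊥-elim (ne e)
    ↦-deterministic (isEmpty-fail _) (isEmpty-fail _) = ⊆-refl , ⊆-refl
    ↦-deterministic seq-id seq-id = ⊆-refl , ⊆-refl
    ↦-deterministic seq-id (seq-step ())
    ↦-deterministic seq-fail seq-fail = ⊆-refl , ⊆-refl
    ↦-deterministic seq-fail (seq-step ())
    ↦-deterministic (seq-step ()) seq-id
    ↦-deterministic (seq-step ()) seq-fail
    ↦-deterministic (seq-step {S₂ = S₂} d) (seq-step d′) =
      let ps⊆qs , qs⊆ps = ↦-deterministic d d′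
          sequence = λ p → [ strat p ⨾ S₂ , lgraph p ]
      in map⁺ sequence ps⊆qs , map⁺ sequence qs⊆ps
    ↦-deterministic (if-then _ _) (if-then _ _) = ⊆-refl , ⊆-refl
    ↦-deterministic (if-then run succeeded) (if-else run′ failed) =
      ⊥-elim (success-excludes-failure ⊆-refl run run′ succeeded failed)
    ↦-deterministic (if-else run failed) (if-then run′ succeeded) =
      ⊥-elim (failure-excludes-success ⊆-refl run run′ failed succeeded)
    ↦-deterministic (if-else _ _) (if-else _ _) = ⊆-refl , ⊆-refl
    ↦-deterministic while-↦ while-↦ = ⊆-refl , ⊆-refl

    ↦-within-stepAll : StepAll C C′ → q ∈ C → q ↦ qs → qs ⊆ C′
    ↦-within-stepAll (keep r _) (here refl) d′ = ⊥-elim (result-stuck r d′)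
    ↦-within-stepAll (change {ps = ps} d _) (here refl) d′ =
      xs⊆xs++ys ps _ ∘ proj₂ (↦-deterministic d d′)
    ↦-within-stepAll (keep _ s) (there q∈C) d′ = there ∘ ↦-within-stepAll s q∈C d′
    ↦-within-stepAll (change {ps = ps} _ s) (there q∈C) d′ =
      xs⊆ys++xs _ ps ∘ ↦-within-stepAll s q∈C d′

    stepAll-⊆ : StepAll C C′ → StepAll D D′ → C ⊆ D → C′ ⊆ D′
    stepAll-⊆ (keep r _) s′ C⊆D (here refl) = stepAll-keeps-result s′ r (C⊆D (here refl))
    stepAll-⊆ (keep _ s) s′ C⊆D (there x∈C′) = stepAll-⊆ s s′ (C⊆D ∘ there) x∈C′
    stepAll-⊆ (change {ps = ps} d s) s′ C⊆D x∈ps++C′ with ∈-++⁻ ps x∈ps++C′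
    ... | inj₂ x∈C′ = stepAll-⊆ s s′ (C⊆D ∘ there) x∈C′
    ... | inj₁ x∈ps with stepAll-lookup s′ (C⊆D (here refl))
    ...   | inj₁ (r , _) = ⊥-elim (result-stuck r d)
    ...   | inj₂ (_ , d′ , qs⊆D′) = qs⊆D′ (proj₁ (↦-deterministic d d′) x∈ps)

    stepAll-⊇ : StepAll C C′ → StepAll D D′ → D ⊆ C → D′ ⊆ C′
    stepAll-⊇ s s′ D⊆C x∈D′ with stepAll-origin s′ x∈D′
    ... | inj₁ (r , x∈D) = stepAll-keeps-result s r (D⊆C x∈D)
    ... | inj₂ (_ , _ , q∈D , d′ , x∈qs) = ↦-within-stepAll s (D⊆C q∈D) d′ x∈qs

    success-excludes-failure : C ⊆ D → C ⟶* M → D ⟶* N → Succeeded M → Failed N → ⊥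
    success-excludes-failure C⊆D ε D⟶*N = success-survives C⊆D D⟶*N
    success-excludes-failure C⊆D (step active _ ◅ _) ε _ failed =
      active-not-failed C⊆D failed active
    success-excludes-failure C⊆D (step _ s ◅ C′⟶*M) (step _ s′ ◅ D′⟶*N) =
      success-excludes-failure (stepAll-⊆ s s′ C⊆D) C′⟶*M D′⟶*N

    failure-excludes-success : D ⊆ C → C ⟶* M → D ⟶* N → Failed M → Succeeded N → ⊥
    failure-excludes-success D⊆C C⟶*M ε failed succeeded =
      success-survives D⊆C C⟶*M succeeded failed
    failure-excludes-success D⊆C ε (step active _ ◅ _) failed _ =
      active-not-failed D⊆C failed active
    failure-excludes-success D⊆C (step _ s ◅ C′⟶*M) (step _ s′ ◅ D′⟶*N) =
      failure-excludes-success (stepAll-⊇ s s′ D⊆C) C′⟶*M D′⟶*N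

  stepAll-of-⊆ : C ⊆ D → StepAll D D′ → ∃ (StepAll C)
  stepAll-of-⊆ {[]} _ _ = [] , []ₛ
  stepAll-of-⊆ {p ∷ C} p∷C⊆D s with stepAll-of-⊆ (p∷C⊆D ∘ there) s
  ... | C′ , steps with stepAll-lookup s (p∷C⊆D (here refl))
  ...   | inj₁ (r , _) = p ∷ C′ , keep r steps
  ...   | inj₂ (ps , d , _) = ps ++ C′ , change d steps

  terminal-resp : C ⊆ D → D ⊆ C → Terminal C → Terminal D
  terminal-resp C⊆D D⊆C C-terminal _ (step active s) =
    let C′ , steps = stepAll-of-⊆ C⊆D s
    in C-terminal C′ (step (Any-resp-⊆ D⊆C active) steps)

  runs-agree : C ⊆ D → D ⊆ C → (run : Run C C′) (run′ : Run D D′) →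
               Terminal C′ → Terminal D′ → p ∈Run run → p ∈Run run′
  runs-agree C⊆D _ done done _ _ p∈C = C⊆D p∈C
  runs-agree C⊆D D⊆C done (next D⟶ _) C-terminal _ _ =
    ⊥-elim (terminal-resp C⊆D D⊆C C-terminal _ D⟶)
  runs-agree C⊆D D⊆C (next C⟶ _) done _ D-terminal _ =
    ⊥-elim (terminal-resp D⊆C C⊆D D-terminal _ C⟶)
  runs-agree C⊆D _ (next _ _) (next _ _) _ _ (inj₁ p∈C) = inj₁ (C⊆D p∈C)
  runs-agree C⊆D D⊆C (next (step _ s) run) (next (step _ s′) run′) t t′ (inj₂ p∈run) =
    inj₂ (runs-agree (stepAll-⊆ s s′ C⊆D) (stepAll-⊆ s′ s D⊆C) run run′ t t′ p∈run)

  resultSet-unique : (r r′ : CompleteRun p) →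
                     InResultSet q (CompleteRun.run r) → InResultSet q (CompleteRun.run r′)
  resultSet-unique r r′ (q-result , q∈r) =
    q-result , runs-agree ⊆-refl ⊆-refl (CompleteRun.run r) (CompleteRun.run r′)
                 (CompleteRun.terminal r) (CompleteRun.terminal r′) q∈r

mainTheorem2 : (𝔉 : PortGraphFramework)
    (ℛ : List (PortGraphFramework.LocRule 𝔉))
    (S : Sem.Strat 𝔉 ℛ) (A : Sem.LocGraph 𝔉 ℛ)
    (r₁ r₂ : Sem.CompleteRun 𝔉 ℛ (Sem.[_,_] S A))
    (x : Sem.Program 𝔉 ℛ) →
    (Sem.InResultSet 𝔉 ℛ x (Sem.CompleteRun.run r₁) →
       Sem.InResultSet 𝔉 ℛ x (Sem.CompleteRun.run r₂))
    × (Sem.InResultSet 𝔉 ℛ x (Sem.CompleteRun.run r₂) →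
       Sem.InResultSet 𝔉 ℛ x (Sem.CompleteRun.run r₁))
mainTheorem2 𝔉 ℛ S A r₁ r₂ x =
  resultSet-unique r₁ r₂ , resultSet-unique r₂ r₁
  where open CoreStrategies 𝔉 ℛ
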